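{- If $G$ is a connected graph with at least three vertices and maximum degree $\Delta(G)$, then \[\lceil \log_2 (1+\Delta(G))\rceil \le \Psi(L(G)) \le |V(G)| - 1.\]
   Context: All graphs are finite, simple and undirected. For a connected graph $H$, $d_H(u,v)$ denotes the distance (number of edges in a shortest path) between $u$ and $v$. A pair $\{x,y\}$ of vertices of $H$ doubly resolves a pair $\{u,v\}$ if $d_H(u,x)-d_H(u,y)\neq d_H(v,x)-d_H(v,y)$. A set $S\subseteq V(H)$ is a doubly resolving set of $H$ if every pair of distinct vertices of $H$ is doubly resolved by some pair of vertices in $S$; $\Psi(H)$ denotes the minimum cardinality of a doubly resolving set of $H$. $L(G)$ is the line graph of $G$: its vertices are the edges of $G$, two being adjacent iff they share an end vertex. -}

module Defs where

open import Data.Nat using (ℕ; zero; suc; _+_; _<_; _⊔_)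
open import Data.Integer using (ℤ; +_; _-_)
open import Data.Fin using (Fin)
open import Data.Fin.Properties using () renaming (_≟_ to _≟ᶠ_)
open import Data.Bool using (Bool; T)
open import Data.List using (List; length; filterᵇ; foldr; map)
open import Data.List.Membership.Propositional using (_∈_)
open import Data.List.Relation.Unary.Unique.Propositional using (Unique)
open import Data.Product using (Σ; _×_; _,_; ∃; proj₁; proj₂)
open import Data.Sum using (_⊎_)
open import Data.Vec.Functional using () 
open import Data.List using () renaming (allFin to allFinL)
open import Relation.Binary.PropositionalEquality using (_≡_; _≢_)
open import Relation.Nullary using (¬_)

module _ {V : Set} (Adj : V → V → Set) where

  data Walk : V → V → ℕ → Set where
    [] : ∀ {u} → Walk u u 0
    _∷_ : ∀ {u w v k} → Adj u w → Walk w v k → Walk u v (suc k)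

  Dist : V → V → ℕ → Set
  Dist u v k = Walk u v k × (∀ m → Walk u v m → k Data.Nat.≤ m)

  Connected : Set
  Connected = ∀ u v → Σ ℕ (Walk u v)

  DoublyResolves : V → V → V → V → Set
  DoublyResolves x y u v =
    ∀ a b c d → Dist u x a → Dist u y b → Dist v x c → Dist v y d →
    (+ a - + b) ≢ (+ c - + d)

  -- S (a duplicate-free list, i.e. a finite set) is doubly resolving
  IsDoublyResolving : List V → Set
  IsDoublyResolving S =
    Unique S ×
    (∀ u v → u ≢ v → ∃ λ x → ∃ λ y → x ∈ S × y ∈ S × DoublyResolves x y u v)

  IsΨ : ℕ → Set
  IsΨ k =
    (Σ (List V) λ S → IsDoublyResolving S × length S ≡ k) ×
    (∀ S → IsDoublyResolving S → k Data.Nat.≤ length S)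

record Graph (n : ℕ) : Set where
  field
    adj     : Fin n → Fin n → Bool
    sym     : ∀ u v → adj u v ≡ adj v u
    irrefl  : ∀ u → ¬ T (adj u u)

  Adj : Fin n → Fin n → Set
  Adj u v = T (adj u v)

  degree : Fin n → ℕ
  degree v = length (filterᵇ (adj v) (allFinL n))

  Δ : ℕ
  Δ = foldr _⊔_ 0 (map degree (allFinL n))

  Edge : Set
  Edge = Σ (Fin n × Fin n) λ p → Data.Fin._<_ (proj₁ p) (proj₂ p) × Adj (proj₁ p) (proj₂ p)

  _∈ₑ_ : Fin n → Edge → Set
  v ∈ₑ ((i , j) , _) = v ≡ i ⊎ v ≡ j

  LAdj : Edge → Edge → Set
  LAdj e f = e ≢ f × ∃ λ v → v ∈ₑ e × v ∈ₑ f

-- The edges at a vertex v are pairwise adjacent in L(G), so their distances to any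
-- edge s differ by at most one, and the bit "strictly above the minimum over the edges at v"
-- determines them up to a common shift. Over a doubly resolving set S, two edges at v whose
-- distance profiles differ by a constant are not doubly resolved, so the bit words of the edges
-- at v are distinct and do not include both the all-ones and the all-zeros word: deg v < 2^|S|.
--
-- Let T be the n - 1 edges of a breadth-first spanning tree rooted at r. Every edge
-- at r lies in T, so a non-tree edge meets a tree edge at each of its ends, and of two distinct
-- non-tree edges some tree edge meets exactly one. Hence any two edges u, v are doubly resolved by
-- two tree edges x, y: the pair itself, a tree edge together with a tree neighbour of the other edge,
-- or a separating tree edge together with a tree neighbour of the other edge. In each case x and y
-- are at distance at most one from u and v respectively, while v is farther from x or u farther
-- from y, so d(u,x) + d(v,y) < d(v,x) + d(u,y).

module Submission where

open import Defs
open import Data.Nat using (ℕ; _≤_; _∸_; _+_)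
open import Data.Nat.Logarithm using (⌈log₂_⌉; ⌈log₂⌉-mono-≤; ⌈log₂2^n⌉≡n)
open import Data.Product using (Σ; _×_; ∃; _,_; proj₁; proj₂)
open import Data.Nat as ℕ using (zero; suc; _<_; _^_; z≤n; s≤s)
open import Data.Nat.Properties as ℕ using (≮⇒≥; ≤-antisym; ≤-trans; _<?_)
open import Data.Integer as ℤ using (ℤ; +_; _-_)
import Data.Integer.Properties as ℤ
open import Data.Integer.Tactic.RingSolver using (solve-∀)
open import Data.Fin as Fin using (Fin; zero; suc; combine; punchOut)
open import Data.Fin.Properties as Fin using (combine-injective; punchOut-injective; injective⇒≤)
open import Data.Bool using (Bool; true; false; T)
open import Data.Bool.Properties using (T-irrelevant)
open import Data.List
  using (List; []; _∷_; length; map; lookup; filterᵇ; cartesianProductWith; cartesianProduct; concatMap; allFin)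
open import Data.List.Membership.Propositional using (_∈_; _∉_; find; lose)
open import Data.List.Membership.Propositional.Properties
  using (∈-cartesianProductWith⁺; ∈-cartesianProduct⁺; ∈-concatMap⁺; ∈-allFin; ∈-lookup; ∈-filter⁻; ∈-map⁺)
open import Data.List.Relation.Unary.All as All using (All; []; _∷_; all?)
open import Data.List.Relation.Unary.Any using (here; there; any?)
import Data.List.Relation.Unary.Unique.DecPropositional as Unique
open import Data.List.Relation.Unary.Unique.Propositional using (Unique)
import Data.List.Relation.Unary.Unique.Propositional.Properties as Unique
import Data.List.Relation.Unary.All.Properties as All
open import Data.List.Relation.Unary.AllPairs using (_∷_)
open import Data.List.Properties using (foldr-preservesᵇ; length-map; length-tabulate)
open import Data.Product.Properties using (≡-dec)
open import Data.Sum using (_⊎_; inj₁; inj₂; [_,_]; swap)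
open import Function using (_∘_; id)
open import Function.Bundles using (_⇔_; mk⇔; Equivalence)
open import Function.Definitions using (Injective)
open import Relation.Binary.Definitions using (DecidableEquality; tri<; tri≈; tri>)
open import Relation.Binary.PropositionalEquality
  using (_≡_; _≢_; ≢-sym; refl; sym; trans; cong; cong₂; subst; module ≡-Reasoning)
open import Relation.Nullary using (¬_; Dec; yes; no; does; contradiction; ¬?)
open import Relation.Nullary.Decidable using (map′; _×-dec_; _⊎-dec_; T?)
open import Relation.Unary as U using ()

[+m]-[+n]≡[+o]-[+p]⇔m+p≡o+n : ∀ m n o p → (+ m - + n ≡ + o - + p) ⇔ (m + p ≡ o + n)
[+m]-[+n]≡[+o]-[+p]⇔m+p≡o+n m n o p = mk⇔ to from
  where
  open ≡-Reasoning
  cancelˡ : ∀ (x y z : ℤ) → (x - y) ℤ.+ (y ℤ.+ z) ≡ x ℤ.+ z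
  cancelˡ = solve-∀
  cancelʳ : ∀ (x y z : ℤ) → (x - z) ℤ.+ (y ℤ.+ z) ≡ x ℤ.+ y
  cancelʳ = solve-∀
  unshift : ∀ (x k : ℤ) → (x ℤ.+ k) - k ≡ x
  unshift = solve-∀
  k : ℤ
  k = + n ℤ.+ + p
  to : + m - + n ≡ + o - + p → m + p ≡ o + n
  to eq = ℤ.+-injective (begin
    + m ℤ.+ + p           ≡⟨ cancelˡ (+ m) (+ n) (+ p) ⟨
    (+ m - + n) ℤ.+ k     ≡⟨ cong (ℤ._+ k) eq ⟩
    (+ o - + p) ℤ.+ k     ≡⟨ cancelʳ (+ o) (+ n) (+ p) ⟩
    + o ℤ.+ + n           ∎)
  from : m + p ≡ o + n → + m - + n ≡ + o - + p
  from eq = begin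
    + m - + n                 ≡⟨ unshift (+ m - + n) k ⟨
    ((+ m - + n) ℤ.+ k) - k   ≡⟨ cong (_- k) (cancelˡ (+ m) (+ n) (+ p)) ⟩
    + (m + p) - k             ≡⟨ cong (λ x → + x - k) eq ⟩
    + (o + n) - k             ≡⟨ cong (_- k) (cancelʳ (+ o) (+ n) (+ p)) ⟨
    ((+ o - + p) ℤ.+ k) - k   ≡⟨ unshift (+ o - + p) k ⟩
    + o - + p                 ∎

module _ {P : ℕ → Set} (P? : U.Decidable P) where

  private
    least-from : ∀ m d → P (d + m) → (∀ {j} → j < m → ¬ P j) →
                 Σ ℕ λ k → P k × (∀ j → P j → k ≤ j)
    least-from m d p none-below with P? m | d
    ... | yes pm | _     = m , pm , λ _ pj → ≮⇒≥ λ j<m → none-below j<m pj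
    ... | no ¬pm | zero  = contradiction p ¬pm
    ... | no ¬pm | suc d = least-from (suc m) d (subst P (sym (ℕ.+-suc d m)) p)
      λ j<1+m → [ none-below , (λ { refl → ¬pm }) ] (ℕ.m<1+n⇒m<n∨m≡n j<1+m)

  least : ∀ {k} → P k → Σ ℕ λ m → P m × (∀ j → P j → m ≤ j)
  least {k} pk = least-from 0 k (subst P (sym (ℕ.+-identityʳ k)) pk) λ ()

module _ {A : Set} where

  ∃∈? : {P : A → Set} → U.Decidable P → ∀ xs → Dec (∃ λ x → x ∈ xs × P x)
  ∃∈? P? xs = map′ find (λ (_ , x∈ , px) → lose x∈ px) (any? P? xs)

  ∈-∉⇒≢ : ∀ {x y : A} {xs} → x ∈ xs → y ∉ xs → x ≢ y
  ∈-∉⇒≢ x∈ y∉ refl = y∉ x∈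

  words : List A → ℕ → List (List A)
  words xs zero    = [] ∷ []
  words xs (suc j) = cartesianProductWith _∷_ xs (words xs j)

  ∈-words : ∀ {xs ys} → All (_∈ xs) ys → ys ∈ words xs (length ys)
  ∈-words []         = here refl
  ∈-words (y∈ ∷ ys∈) = ∈-cartesianProductWith⁺ _∷_ y∈ (∈-words ys∈)

bitFin : Bool → Fin 2
bitFin false = zero
bitFin true  = suc zero

bitFin-injective : Injective _≡_ _≡_ bitFin
bitFin-injective {false} {false} _ = refl
bitFin-injective {true}  {true}  _ = refl

module _ {A : Set} where

  encode : (S : List A) → (A → Bool) → Fin (2 ^ length S)
  encode []      f = zero
  encode (s ∷ S) f = combine (bitFin (f s)) (encode S f)

  encode-injective : ∀ S {f g} → encode S f ≡ encode S g → ∀ {s} → s ∈ S → f s ≡ g s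
  encode-injective (s ∷ S) {f} {g} eq s∈
    with combine-injective (bitFin (f s)) (encode S f) (bitFin (g s)) (encode S g) eq
  encode-injective (s ∷ S) eq (here refl) | head≡ , _ = bitFin-injective head≡
  encode-injective (s ∷ S) eq (there s∈)  | _ , tail≡ = encode-injective S tail≡ s∈

lookup-injective : ∀ {A : Set} {xs : List A} → Unique xs → Injective _≡_ _≡_ (lookup xs)
lookup-injective {xs = _ ∷ _}  (_ ∷ _)  {zero}  {zero}  _  = refl
lookup-injective {xs = _ ∷ xs} (x≢ ∷ _) {zero}  {suc j} eq =
  contradiction eq (All.lookup x≢ (∈-lookup {xs = xs} j))
lookup-injective {xs = _ ∷ xs} (x≢ ∷ _) {suc i} {zero}  eq =
  contradiction (sym eq) (All.lookup x≢ (∈-lookup {xs = xs} i))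
lookup-injective {xs = _ ∷ _}  (_ ∷ u)  {suc i} {suc j} eq = cong suc (lookup-injective u eq)

injective-missing⇒< : ∀ {m n} {f : Fin m → Fin n} → Injective _≡_ _≡_ f →
                      (y : Fin n) → (∀ i → y ≢ f i) → m < n
injective-missing⇒< {n = suc n} {f} f-inj y y≢f =
  s≤s (injective⇒≤ {f = λ i → punchOut (y≢f i)} λ eq →
    f-inj (punchOut-injective (y≢f _) (y≢f _) eq))

module AboveMinimum {m} (d : Fin m → ℕ) (spread : ∀ i j → d i ≤ suc (d j)) where

  aboveMin : Fin m → Bool
  aboveMin i = does (Fin.any? λ j → d j <? d i)

  aboveMin-true : ∀ {i} → aboveMin i ≡ true → ∃ λ j → d j < d i
  aboveMin-true {i} eq with Fin.any? (λ j → d j <? d i)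
  ... | yes below = below

  aboveMin-false : ∀ {i} → aboveMin i ≡ false → ∀ j → d i ≤ d j
  aboveMin-false {i} eq j with Fin.any? (λ j → d j <? d i)
  ... | no ¬below = ≮⇒≥ λ j<i → ¬below (j , j<i)

  aboveMin-≡ : ∀ i j → aboveMin i ≡ aboveMin j → d i ≡ d j
  aboveMin-≡ i j same with aboveMin i in eqᵢ
  ... | true  = let (k , k<i) = aboveMin-true eqᵢ; (l , l<j) = aboveMin-true (sym same) in
                ≤-antisym (≤-trans (spread i l) l<j) (≤-trans (spread j k) k<i)
  ... | false = ≤-antisym (aboveMin-false eqᵢ j) (aboveMin-false (sym same) i)

  aboveMin-true-false : ∀ {i j} → aboveMin i ≡ true → aboveMin j ≡ false → d i ≡ suc (d j)
  aboveMin-true-false {i} {j} above notAbove =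
    let (k , k<i) = aboveMin-true above in
    ≤-antisym (spread i j) (≤-trans (s≤s (aboveMin-false notAbove k)) k<i)

module _ {V : Set} {Adj : V → V → Set} where

  _++ʷ_ : ∀ {u v w k l} → Walk Adj u v k → Walk Adj v w l → Walk Adj u w (k + l)
  []      ++ʷ q = q
  (a ∷ p) ++ʷ q = a ∷ (p ++ʷ q)

module FiniteGraph {V : Set} (Adj : V → V → Set) (adj? : ∀ u v → Dec (Adj u v))
                   (_≟_ : DecidableEquality V) (vertices : List V) (∈-vertices : ∀ v → v ∈ vertices)
                   (loopless : ∀ {u v} → Adj u v → u ≢ v) (connected : Connected Adj) where

  ∀? : {P : V → Set} → U.Decidable P → Dec (∀ v → P v)
  ∀? P? = map′ (λ all v → All.lookup all (∈-vertices v)) (λ h → All.tabulate λ {v} _ → h v)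
               (all? P? vertices)

  walk? : ∀ k u v → Dec (Walk Adj u v k)
  walk? zero    u v = map′ (λ { refl → [] }) (λ { [] → refl }) (u ≟ v)
  walk? (suc k) u v = map′ (λ (_ , _ , a , p) → a ∷ p) (λ { (a ∷ p) → _ , ∈-vertices _ , a , p })
                           (∃∈? (λ w → adj? u w ×-dec walk? k w v) vertices)

  opaque
    shortest : ∀ u v → Σ ℕ (Dist Adj u v)
    shortest u v = least (λ k → walk? k u v) (proj₂ (connected u v))

  dist : V → V → ℕ
  dist u v = proj₁ (shortest u v)

  Dist-dist : ∀ u v → Dist Adj u v (dist u v)
  Dist-dist u v = proj₂ (shortest u v)

  dist-walk : ∀ u v → Walk Adj u v (dist u v)
  dist-walk u v = proj₁ (Dist-dist u v)

  dist-minimal : ∀ {u v k} → Walk Adj u v k → dist u v ≤ k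
  dist-minimal {u} {v} = proj₂ (Dist-dist u v) _

  Dist⇒≡dist : ∀ {u v k} → Dist Adj u v k → k ≡ dist u v
  Dist⇒≡dist (walk , minimal) = ≤-antisym (minimal _ (dist-walk _ _)) (dist-minimal walk)

  dist-refl : ∀ u → dist u u ≡ 0
  dist-refl u = ℕ.n≤0⇒n≡0 (dist-minimal [])

  dist≡0⇒≡ : ∀ {u v} → dist u v ≡ 0 → u ≡ v
  dist≡0⇒≡ {u} {v} d≡0 with dist u v | dist-walk u v
  ... | zero  | [] = refl
  ... | suc _ | _  = contradiction d≡0 λ ()

  1≤dist : ∀ {u v} → u ≢ v → 1 ≤ dist u v
  1≤dist u≢v = ℕ.n≢0⇒n>0 (u≢v ∘ dist≡0⇒≡)

  dist-adj : ∀ {u v} → Adj u v → dist u v ≡ 1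
  dist-adj a = ≤-antisym (dist-minimal (a ∷ [])) (1≤dist (loopless a))

  2≤dist : ∀ {u v} → u ≢ v → ¬ Adj u v → 2 ≤ dist u v
  2≤dist {u} {v} u≢v ¬a with dist u v | dist-walk u v
  ... | zero        | []     = contradiction refl u≢v
  ... | suc zero    | a ∷ [] = contradiction a ¬a
  ... | suc (suc _) | _      = s≤s (s≤s z≤n)

  dist-step : ∀ {u w} s → Adj u w → dist u s ≤ suc (dist w s)
  dist-step s a = dist-minimal (a ∷ dist-walk _ s)

  closer-neighbour : ∀ {u v} → u ≢ v → ∃ λ w → Adj u w × suc (dist w v) ≡ dist u v
  closer-neighbour {u} {v} u≢v with dist u v in d≡ | dist-walk u v
  ... | zero  | []       = contradiction refl u≢v
  ... | suc k | a ∷ rest =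
    _ , a , ≤-antisym (s≤s (dist-minimal rest)) (subst (_≤ suc _) d≡ (dist-step v a))

  DoublyResolves⇔ : ∀ {x y u v} →
                    DoublyResolves Adj x y u v ⇔ (dist u x + dist v y ≢ dist v x + dist u y)
  DoublyResolves⇔ {x} {y} {u} {v} = mk⇔ to from
    where
    to : DoublyResolves Adj x y u v → dist u x + dist v y ≢ dist v x + dist u y
    to dr eq = dr _ _ _ _ (Dist-dist u x) (Dist-dist u y) (Dist-dist v x) (Dist-dist v y)
                 (Equivalence.from ([+m]-[+n]≡[+o]-[+p]⇔m+p≡o+n (dist u x) (dist u y) (dist v x) (dist v y)) eq)
    from : dist u x + dist v y ≢ dist v x + dist u y → DoublyResolves Adj x y u v
    from ne a b c d ux uy vx vy eq
      with Dist⇒≡dist ux | Dist⇒≡dist uy | Dist⇒≡dist vx | Dist⇒≡dist vy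
    ... | refl | refl | refl | refl = ne (Equivalence.to ([+m]-[+n]≡[+o]-[+p]⇔m+p≡o+n a b c d) eq)

  DoublyResolves-sym : ∀ {x y u v} → DoublyResolves Adj x y u v → DoublyResolves Adj x y v u
  DoublyResolves-sym dr a b c d vx vy ux uy eq = dr c d a b ux uy vx vy (sym eq)

  <⇒DoublyResolves : ∀ {x y u v} → dist u x + dist v y < dist v x + dist u y →
                     DoublyResolves Adj x y u v
  <⇒DoublyResolves lt = Equivalence.from DoublyResolves⇔ (ℕ.<⇒≢ lt)

  DoublyResolves-self : ∀ {u v} → u ≢ v → DoublyResolves Adj u v u v
  DoublyResolves-self {u} {v} u≢v = <⇒DoublyResolves (begin-strict
    dist u u + dist v v  ≡⟨ cong₂ _+_ (dist-refl u) (dist-refl v) ⟩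
    0                    <⟨ 1≤dist (u≢v ∘ sym) ⟩
    dist v u             ≤⟨ ℕ.m≤m+n _ _ ⟩
    dist v u + dist u v  ∎)
    where open ℕ.≤-Reasoning

  DoublyResolves-neighbour : ∀ {u v y} → u ≢ v → u ≢ y → Adj v y → DoublyResolves Adj u y u v
  DoublyResolves-neighbour {u} {v} {y} u≢v u≢y vy = <⇒DoublyResolves (begin-strict
    dist u u + dist v y  ≡⟨ cong₂ _+_ (dist-refl u) (dist-adj vy) ⟩
    1                    <⟨ ℕ.+-mono-≤ (1≤dist (u≢v ∘ sym)) (1≤dist u≢y) ⟩
    dist v u + dist u y  ∎)
    where open ℕ.≤-Reasoning

  DoublyResolves-separating : ∀ {u v x y} → Adj u x → v ≢ x → ¬ Adj v x → Adj v y → u ≢ y →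
                              DoublyResolves Adj x y u v
  DoublyResolves-separating {u} {v} {x} {y} ux v≢x ¬vx vy u≢y = <⇒DoublyResolves (begin-strict
    dist u x + dist v y  ≡⟨ cong₂ _+_ (dist-adj ux) (dist-adj vy) ⟩
    2                    <⟨ ℕ.+-mono-≤ (2≤dist v≢x ¬vx) (1≤dist u≢y) ⟩
    dist v x + dist u y  ∎)
    where open ℕ.≤-Reasoning

  doublyResolving-offset⇒≡ : ∀ {S u v} c → IsDoublyResolving Adj S →
                             (∀ {s} → s ∈ S → dist u s ≡ c + dist v s) → u ≡ v
  doublyResolving-offset⇒≡ {S} {u} {v} c (_ , resolves) offset with u ≟ v
  ... | yes u≡v = u≡v
  ... | no u≢v  =
    let (x , y , x∈ , y∈ , dr) = resolves u v u≢v in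
    contradiction (begin
      dist u x + dist v y        ≡⟨ cong (_+ dist v y) (offset x∈) ⟩
      c + dist v x + dist v y    ≡⟨ cong (_+ dist v y) (ℕ.+-comm c _) ⟩
      dist v x + c + dist v y    ≡⟨ ℕ.+-assoc (dist v x) c _ ⟩
      dist v x + (c + dist v y)  ≡⟨ cong (λ z → dist v x + z) (offset y∈) ⟨
      dist v x + dist u y        ∎) (Equivalence.to DoublyResolves⇔ dr)
    where open ≡-Reasoning

  doublyResolves? : ∀ x y u v → Dec (DoublyResolves Adj x y u v)
  doublyResolves? x y u v =
    map′ (Equivalence.from DoublyResolves⇔) (Equivalence.to DoublyResolves⇔) (¬? (_ ℕ.≟ _))

  ResolvedBy : List V → V → V → Set
  ResolvedBy S u v = ∃ λ x → ∃ λ y → x ∈ S × y ∈ S × DoublyResolves Adj x y u v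

  ResolvedBy-sym : ∀ {S u v} → ResolvedBy S u v → ResolvedBy S v u
  ResolvedBy-sym (x , y , x∈ , y∈ , dr) = x , y , x∈ , y∈ , DoublyResolves-sym dr

  resolvedBy? : ∀ S u v → Dec (u ≢ v → ResolvedBy S u v)
  resolvedBy? S u v with u ≟ v
  ... | yes refl = yes λ u≢u → contradiction refl u≢u
  ... | no u≢v   = map′ (λ (x , x∈ , y , y∈ , dr) _ → x , y , x∈ , y∈ , dr)
                        (λ r → let (x , y , x∈ , y∈ , dr) = r u≢v in x , x∈ , y , y∈ , dr)
                        (∃∈? (λ x → ∃∈? (λ y → doublyResolves? x y u v) S) S)

  isDoublyResolving? : ∀ S → Dec (IsDoublyResolving Adj S)
  isDoublyResolving? S = Unique.unique? _≟_ S ×-dec ∀? (λ u → ∀? (resolvedBy? S u))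

  DoublyResolvingOfSize : ℕ → Set
  DoublyResolvingOfSize k = Σ (List V) λ S → IsDoublyResolving Adj S × length S ≡ k

  ∈-words-vertices : ∀ {S} → S ∈ words vertices (length S)
  ∈-words-vertices = ∈-words (All.tabulate λ _ → ∈-vertices _)

  doublyResolvingOfSize? : U.Decidable DoublyResolvingOfSize
  doublyResolvingOfSize? k =
    map′ (λ (S , _ , dr , len) → S , dr , len)
         (λ (S , dr , len) → S , subst (λ j → S ∈ words vertices j) len ∈-words-vertices , dr , len)
         (∃∈? (λ S → isDoublyResolving? S ×-dec (length S ℕ.≟ k)) (words vertices k))

  Ψ-exists : ∀ {S} → IsDoublyResolving Adj S → Σ ℕ λ k → IsΨ Adj k × k ≤ length S
  Ψ-exists {S} dr =
    let (k , sized , minimal) = least doublyResolvingOfSize? (S , dr , refl) in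
    k , (sized , λ T drT → minimal _ (T , drT , refl)) , minimal _ (S , dr , refl)

module LineGraph {n : ℕ} (G : Graph n) where

  open Graph G using (Adj; adj; irrefl; Edge; _∈ₑ_; LAdj) renaming (sym to adj-sym)

  Adj-sym : ∀ {u v} → Adj u v → Adj v u
  Adj-sym {u} {v} = subst T (adj-sym u v)

  Adj⇒≢ : ∀ {u v} → Adj u v → u ≢ v
  Adj⇒≢ a refl = irrefl _ a

  adj? : ∀ u v → Dec (Adj u v)
  adj? u v = T? (adj u v)

  ends-injective : ∀ {e f : Edge} → proj₁ e ≡ proj₁ f → e ≡ f
  ends-injective {_ , i<j , a} {_ , i<j′ , a′} refl =
    cong₂ (λ p q → (_ , p , q)) (Fin.<-irrelevant i<j i<j′) (T-irrelevant a a′)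

  _≟ₑ_ : DecidableEquality Edge
  e ≟ₑ f = map′ ends-injective (cong proj₁) (≡-dec Fin._≟_ Fin._≟_ (proj₁ e) (proj₁ f))

  edgesAt : Fin n × Fin n → List Edge
  edgesAt (i , j) with i Fin.<? j | adj? i j
  ... | yes i<j | yes a = ((i , j) , i<j , a) ∷ []
  ... | _       | _     = []

  ∈-edgesAt : ∀ e → e ∈ edgesAt (proj₁ e)
  ∈-edgesAt ((i , j) , i<j , a) with i Fin.<? j | adj? i j
  ... | yes _   | yes _ = here (ends-injective refl)
  ... | no ¬i<j | _     = contradiction i<j ¬i<j
  ... | yes _   | no ¬a = contradiction a ¬a

  edges : List Edge
  edges = concatMap edgesAt (cartesianProduct (allFin n) (allFin n))

  ∈-edges : ∀ e → e ∈ edges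
  ∈-edges e@((i , j) , _) =
    ∈-concatMap⁺ edgesAt (lose (∈-cartesianProduct⁺ (∈-allFin i) (∈-allFin j)) (∈-edgesAt e))

  _∈ₑ?_ : ∀ v e → Dec (v ∈ₑ e)
  v ∈ₑ? ((i , j) , _) = (v Fin.≟ i) ⊎-dec (v Fin.≟ j)

  ShareEnd : Edge → Edge → Set
  ShareEnd e f = ∃ λ v → v ∈ₑ e × v ∈ₑ f

  shareEnd? : ∀ e f → Dec (ShareEnd e f)
  shareEnd? e f = map′ (λ (v , _ , ve , vf) → v , ve , vf) (λ (v , ve , vf) → v , ∈-allFin v , ve , vf)
                       (∃∈? (λ v → (v ∈ₑ? e) ×-dec (v ∈ₑ? f)) (allFin n))

  LAdj? : ∀ e f → Dec (LAdj e f)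
  LAdj? e f = ¬? (e ≟ₑ f) ×-dec shareEnd? e f

  edge : ∀ {u v} → Adj u v → Edge
  edge {u} {v} a with Fin.<-cmp u v
  ... | tri< u<v _ _ = (u , v) , u<v , a
  ... | tri≈ _ u≡v _ = contradiction u≡v (Adj⇒≢ a)
  ... | tri> _ _ v<u = (v , u) , v<u , Adj-sym a

  ∈ₑ-edge : ∀ {u v w} (a : Adj u v) → w ∈ₑ edge a ⇔ (w ≡ u ⊎ w ≡ v)
  ∈ₑ-edge {u} {v} a with Fin.<-cmp u v
  ... | tri< _ _ _   = mk⇔ id id
  ... | tri≈ _ u≡v _ = contradiction u≡v (Adj⇒≢ a)
  ... | tri> _ _ _   = mk⇔ swap swap

  ∈ₑ-edgeˡ : ∀ {u v} (a : Adj u v) → u ∈ₑ edge a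
  ∈ₑ-edgeˡ a = Equivalence.from (∈ₑ-edge a) (inj₁ refl)

  ∈ₑ-edgeʳ : ∀ {u v} (a : Adj u v) → v ∈ₑ edge a
  ∈ₑ-edgeʳ a = Equivalence.from (∈ₑ-edge a) (inj₂ refl)

  ∈ₑ-other : ∀ {v e} → v ∈ₑ e → ∃ λ w → w ∈ₑ e × Adj v w
  ∈ₑ-other {e = (_ , _ , a)} (inj₁ refl) = _ , inj₂ refl , a
  ∈ₑ-other {e = (_ , _ , a)} (inj₂ refl) = _ , inj₁ refl , Adj-sym a

  ∈ₑ-ends : ∀ {u w} e → u ∈ₑ e → w ∈ₑ e → u Fin.< w → proj₁ e ≡ (u , w)
  ∈ₑ-ends _             (inj₁ refl) (inj₁ refl) u<u = contradiction refl (Fin.<⇒≢ u<u)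
  ∈ₑ-ends _             (inj₁ refl) (inj₂ refl) _   = refl
  ∈ₑ-ends (_ , i<j , _) (inj₂ refl) (inj₁ refl) j<i = contradiction i<j (Fin.<-asym j<i)
  ∈ₑ-ends _             (inj₂ refl) (inj₂ refl) u<u = contradiction refl (Fin.<⇒≢ u<u)

  ∈ₑ-unique : ∀ {u w e f} → u ≢ w → u ∈ₑ e → w ∈ₑ e → u ∈ₑ f → w ∈ₑ f → e ≡ f
  ∈ₑ-unique {u} {w} {e} {f} u≢w ue we uf wf with Fin.<-cmp u w
  ... | tri< u<w _ _ = ends-injective (trans (∈ₑ-ends e ue we u<w) (sym (∈ₑ-ends f uf wf u<w)))
  ... | tri≈ _ u≡w _ = contradiction u≡w u≢w
  ... | tri> _ _ w<u = ends-injective (trans (∈ₑ-ends e we ue w<u) (sym (∈ₑ-ends f wf uf w<u)))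

  shareEnd⇒walk : ∀ {e f} → ShareEnd e f → Σ ℕ (Walk LAdj e f)
  shareEnd⇒walk {e} {f} s with e ≟ₑ f
  ... | yes refl = 0 , []
  ... | no e≢f   = 1 , (e≢f , s) ∷ []

  lift-walk : ∀ {v c k e} → Walk Adj v c k → v ∈ₑ e → ∃ λ f → c ∈ₑ f × Σ ℕ (Walk LAdj e f)
  lift-walk []      v∈e = _ , v∈e , 0 , []
  lift-walk {e = e} (a ∷ p) v∈e =
    let (f , c∈f , _ , q) = lift-walk p (∈ₑ-edgeʳ a)
        (_ , step)        = shareEnd⇒walk {e} {edge a} (_ , v∈e , ∈ₑ-edgeˡ a)
    in f , c∈f , _ , step ++ʷ q

  L-connected : Connected Adj → Connected LAdj
  L-connected connected e@((a , _) , _) f@((c , _) , _) =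
    let (g , c∈g , _ , p) = lift-walk (proj₂ (connected a c)) (inj₁ refl)
        (_ , q)           = shareEnd⇒walk (c , c∈g , inj₁ refl)
    in _ , p ++ʷ q

module DegreeBound {n : ℕ} (G : Graph n) (connected : Connected (Graph.Adj G)) where

  open Graph G using (Adj; adj; degree; Δ; Edge; _∈ₑ_; LAdj)
  open LineGraph G
  open FiniteGraph LAdj LAdj? _≟ₑ_ edges ∈-edges proj₁ (L-connected connected)

  module Star (v : Fin n) where

    neighbour : Fin (degree v) → Fin n
    neighbour = lookup (filterᵇ (adj v) (allFin n))

    neighbour-adj : ∀ i → Adj v (neighbour i)
    neighbour-adj i = proj₂ (∈-filter⁻ (T? ∘ adj v) {xs = allFin n} (∈-lookup i))

    neighbour-injective : Injective _≡_ _≡_ neighbour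
    neighbour-injective = lookup-injective (Unique.filter⁺ (T? ∘ adj v) (Unique.allFin⁺ n))

    spoke : Fin (degree v) → Edge
    spoke i = edge (neighbour-adj i)

    spoke-injective : Injective _≡_ _≡_ spoke
    spoke-injective {i} {j} eq
      with Equivalence.to (∈ₑ-edge (neighbour-adj j))
                          (subst (neighbour i ∈ₑ_) eq (∈ₑ-edgeʳ (neighbour-adj i)))
    ... | inj₁ nᵢ≡v  = contradiction (sym nᵢ≡v) (Adj⇒≢ (neighbour-adj i))
    ... | inj₂ nᵢ≡nⱼ = neighbour-injective nᵢ≡nⱼ

    distFromSpoke : Edge → Fin (degree v) → ℕ
    distFromSpoke s i = dist (spoke i) s

    spoke-spread : ∀ s i j → distFromSpoke s i ≤ suc (distFromSpoke s j)
    spoke-spread s i j with spoke i ≟ₑ spoke j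
    ... | yes sᵢ≡sⱼ = ℕ.m≤n⇒m≤1+n (ℕ.≤-reflexive (cong (λ e → dist e s) sᵢ≡sⱼ))
    ... | no sᵢ≢sⱼ  = dist-step s (sᵢ≢sⱼ , v , ∈ₑ-edgeˡ _ , ∈ₑ-edgeˡ _)

    module Profile (s : Edge) = AboveMinimum (distFromSpoke s) (spoke-spread s)

    profile : Fin (degree v) → Edge → Bool
    profile i s = Profile.aboveMin s i

    module _ {S : List Edge} (resolving : IsDoublyResolving LAdj S) where

      code : Fin (degree v) → Fin (2 ^ length S)
      code i = encode S (profile i)

      code-injective : Injective _≡_ _≡_ code
      code-injective {i} {j} eq = spoke-injective (doublyResolving-offset⇒≡ 0 resolving λ s∈ →
        Profile.aboveMin-≡ _ i j (encode-injective S eq s∈))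

      allTrue allFalse : Fin (2 ^ length S)
      allTrue  = encode S (λ _ → true)
      allFalse = encode S (λ _ → false)

      allTrue⇒¬allFalse : ∀ {s₀} → s₀ ∈ S → ∀ {i j} → code i ≡ allTrue → code j ≢ allFalse
      allTrue⇒¬allFalse s₀∈ {i} {j} i-true j-false with
        spoke-injective (doublyResolving-offset⇒≡ 1 resolving λ s∈ →
          Profile.aboveMin-true-false _ (encode-injective S i-true s∈) (encode-injective S j-false s∈))
      ... | refl = contradiction
                     (trans (sym (encode-injective S i-true s₀∈)) (encode-injective S j-false s₀∈)) λ ()

      degree<2^ : ∀ {s₀} → s₀ ∈ S → degree v < 2 ^ length S
      degree<2^ s₀∈ with Fin.any? (λ j → code j Fin.≟ allFalse)
      ... | yes (j , j-false) = injective-missing⇒< code-injective allTrue λ i i-true →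
                                  allTrue⇒¬allFalse s₀∈ (sym i-true) j-false
      ... | no ¬any-false     = injective-missing⇒< code-injective allFalse λ i i-false →
                                  ¬any-false (i , sym i-false)

  ⌈log₂1+Δ⌉≤ : ∀ {S s₀} → IsDoublyResolving LAdj S → s₀ ∈ S → ⌈log₂ (1 + Δ) ⌉ ≤ length S
  ⌈log₂1+Δ⌉≤ {S} resolving s₀∈ =
    subst (⌈log₂ (1 + Δ) ⌉ ≤_) (⌈log₂2^n⌉≡n (length S)) (⌈log₂⌉-mono-≤ Δ<2^)
    where
    Δ<2^ : Δ < 2 ^ length S
    Δ<2^ = foldr-preservesᵇ {P = _< 2 ^ length S} ℕ.⊔-pres-<m (ℕ.m^n>0 2 (length S))
             (All.map⁺ (All.universal (λ v → Star.degree<2^ v resolving s₀∈) (allFin n)))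

module BreadthFirstTree {n : ℕ} (G : Graph (suc n)) (connected : Connected (Graph.Adj G)) where

  open Graph G using (Adj; irrefl; Edge; _∈ₑ_; LAdj)
  open LineGraph G
  open FiniteGraph Adj adj? Fin._≟_ (allFin (suc n)) ∈-allFin Adj⇒≢ connected
    using (dist; dist-refl; dist≡0⇒≡; dist-step; closer-neighbour)

  depth : Fin (suc n) → ℕ
  depth v = dist v zero

  parent-spec : ∀ i → ∃ λ w → Adj (suc i) w × suc (depth w) ≡ depth (suc i)
  parent-spec i = closer-neighbour λ ()

  parent : Fin n → Fin (suc n)
  parent i = proj₁ (parent-spec i)

  parent-adj : ∀ i → Adj (suc i) (parent i)
  parent-adj i = proj₁ (proj₂ (parent-spec i))

  depth-parent : ∀ i → suc (depth (parent i)) ≡ depth (suc i)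
  depth-parent i = proj₂ (proj₂ (parent-spec i))

  parent≡root : ∀ {i} → Adj zero (suc i) → parent i ≡ zero
  parent≡root {i} a = dist≡0⇒≡ (ℕ.n≤0⇒n≡0 (ℕ.≤-pred (begin
    suc (depth (parent i))  ≡⟨ depth-parent i ⟩
    depth (suc i)           ≤⟨ dist-step zero (Adj-sym a) ⟩
    suc (depth zero)        ≡⟨ cong suc (dist-refl zero) ⟩
    1                       ∎)))
    where open ℕ.≤-Reasoning

  treeEdge : Fin n → Edge
  treeEdge i = edge (parent-adj i)

  treeEdges : List Edge
  treeEdges = map treeEdge (allFin n)

  length-treeEdges : length treeEdges ≡ n
  length-treeEdges = trans (length-map treeEdge (allFin n)) (length-tabulate id)

  treeEdge∈ : ∀ i → treeEdge i ∈ treeEdges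
  treeEdge∈ i = ∈-map⁺ treeEdge (∈-allFin i)

  ∈ₑ-treeEdge : ∀ {w i} → w ∈ₑ treeEdge i → w ≡ suc i ⊎ w ≡ parent i
  ∈ₑ-treeEdge = Equivalence.to (∈ₑ-edge (parent-adj _))

  ends⇒treeEdge : ∀ {e i} → suc i ∈ₑ e → parent i ∈ₑ e → e ≡ treeEdge i
  ends⇒treeEdge {i = i} si∈e pi∈e =
    ∈ₑ-unique (Adj⇒≢ (parent-adj i)) si∈e pi∈e (∈ₑ-edgeˡ (parent-adj i)) (∈ₑ-edgeʳ (parent-adj i))

  treeEdge-injective : Injective _≡_ _≡_ treeEdge
  treeEdge-injective {i} {j} eq
    with ∈ₑ-treeEdge (subst (suc i ∈ₑ_) eq (∈ₑ-edgeˡ (parent-adj i)))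
       | ∈ₑ-treeEdge (subst (suc j ∈ₑ_) (sym eq) (∈ₑ-edgeˡ (parent-adj j)))
  ... | inj₁ sᵢ≡sⱼ | _          = Fin.suc-injective sᵢ≡sⱼ
  ... | _          | inj₁ sⱼ≡sᵢ = sym (Fin.suc-injective sⱼ≡sᵢ)
  ... | inj₂ sᵢ≡pⱼ | inj₂ sⱼ≡pᵢ = contradiction
          (ℕ.<-trans (subst (λ w → depth w < depth (suc j)) (sym sᵢ≡pⱼ) (ℕ.≤-reflexive (depth-parent j)))
                     (subst (λ w → depth w < depth (suc i)) (sym sⱼ≡pᵢ) (ℕ.≤-reflexive (depth-parent i))))
          (ℕ.<-irrefl refl)

  treeEdges-unique : Unique treeEdges
  treeEdges-unique = Unique.map⁺ treeEdge-injective (Unique.allFin⁺ n)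

  root-edge∈ : ∀ {e} → zero ∈ₑ e → e ∈ treeEdges
  root-edge∈ {e} z∈e with ∈ₑ-other {e = e} z∈e
  ... | zero  , _   , a = contradiction a (irrefl zero)
  ... | suc j , j∈e , a =
    subst (_∈ treeEdges) (sym (ends⇒treeEdge j∈e (subst (_∈ₑ e) (sym (parent≡root a)) z∈e))) (treeEdge∈ j)

  LAdj-treeEdge : ∀ {e i} → e ∉ treeEdges → suc i ∈ₑ e → LAdj e (treeEdge i)
  LAdj-treeEdge {i = i} e∉ si∈e =
    (λ { refl → e∉ (treeEdge∈ i) }) , suc i , si∈e , ∈ₑ-edgeˡ (parent-adj i)

  tree-neighbour : ∀ {e} → e ∉ treeEdges → ∀ u → ∃ λ y → y ∈ treeEdges × LAdj e y × y ≢ u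
  tree-neighbour {(zero , _) , _} e∉ _ = contradiction (root-edge∈ (inj₁ refl)) e∉
  tree-neighbour {(_ , zero) , _} e∉ _ = contradiction (root-edge∈ (inj₂ refl)) e∉
  tree-neighbour {(suc i , suc j) , i<j , _} e∉ u with treeEdge i ≟ₑ u
  ... | no tᵢ≢u  = treeEdge i , treeEdge∈ i , LAdj-treeEdge e∉ (inj₁ refl) , tᵢ≢u
  ... | yes tᵢ≡u = treeEdge j , treeEdge∈ j , LAdj-treeEdge e∉ (inj₂ refl) ,
                   λ tⱼ≡u → Fin.<⇒≢ i<j (cong suc (treeEdge-injective (trans tᵢ≡u (sym tⱼ≡u))))

  Separates : Edge → Edge → Edge → Set
  Separates e f x = (LAdj e x × ¬ LAdj f x) ⊎ (LAdj f x × ¬ LAdj e x)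

  -- The tree edge at v meets e there; if it also meets f, it does so at the parent of v, which
  -- then lies on f but not on e, and the search continues one level up with e and f exchanged.
  separating-from : ∀ k {e f v} → depth v ≡ k → e ∉ treeEdges → f ∉ treeEdges →
                    v ∈ₑ e → ¬ v ∈ₑ f → ∃ λ x → x ∈ treeEdges × Separates e f x
  separating-from _ {v = zero} _ e∉ _ z∈e _ = contradiction (root-edge∈ z∈e) e∉
  separating-from zero {v = suc i} d≡0 _ _ _ _ = contradiction (dist≡0⇒≡ d≡0) λ ()
  separating-from (suc k) {e} {f} {suc i} d≡1+k e∉ f∉ si∈e si∉f with LAdj? f (treeEdge i)
  ... | no ¬f~t = treeEdge i , treeEdge∈ i , inj₁ (LAdj-treeEdge e∉ si∈e , ¬f~t)
  ... | yes (_ , w , w∈f , w∈t) with ∈ₑ-treeEdge w∈t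
  ...   | inj₁ refl = contradiction w∈f si∉f
  ...   | inj₂ refl =
    let p∉e : ¬ parent i ∈ₑ e
        p∉e p∈e = e∉ (subst (_∈ treeEdges) (sym (ends⇒treeEdge si∈e p∈e)) (treeEdge∈ i))
        (x , x∈ , sep) = separating-from k (ℕ.suc-injective (trans (depth-parent i) d≡1+k)) f∉ e∉ w∈f p∉e
    in x , x∈ , swap sep

  separating-treeEdge : ∀ {e f} → e ∉ treeEdges → f ∉ treeEdges → e ≢ f →
                        ∃ λ x → x ∈ treeEdges × Separates e f x
  separating-treeEdge {e@((a , b) , _ , ab)} {f} e∉ f∉ e≢f with a ∈ₑ? f | b ∈ₑ? f
  ... | no a∉f  | _       = separating-from _ refl e∉ f∉ (inj₁ refl) a∉f
  ... | _       | no b∉f  = separating-from _ refl e∉ f∉ (inj₂ refl) b∉f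
  ... | yes a∈f | yes b∈f = contradiction (∈ₑ-unique (Adj⇒≢ ab) (inj₁ refl) (inj₂ refl) a∈f b∈f) e≢f

module TreeEdgesResolving {n : ℕ} (G : Graph (suc n)) (connected : Connected (Graph.Adj G)) where

  open Graph G using (LAdj)
  open LineGraph G
  open BreadthFirstTree G connected
  open FiniteGraph LAdj LAdj? _≟ₑ_ edges ∈-edges proj₁ (L-connected connected)
  open import Data.List.Membership.DecPropositional _≟ₑ_ using (_∈?_)

  resolvedBy-tree-nontree : ∀ {u v} → u ∈ treeEdges → v ∉ treeEdges → ResolvedBy treeEdges u v
  resolvedBy-tree-nontree {u} u∈ v∉ =
    let (y , y∈ , v~y , y≢u) = tree-neighbour v∉ u in
    u , y , u∈ , y∈ , DoublyResolves-neighbour (∈-∉⇒≢ u∈ v∉) (≢-sym y≢u) v~y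

  resolvedBy-nontree : ∀ {u v} → u ∉ treeEdges → v ∉ treeEdges → u ≢ v → ResolvedBy treeEdges u v
  resolvedBy-nontree {u} {v} u∉ v∉ u≢v with separating-treeEdge u∉ v∉ u≢v
  ... | x , x∈ , inj₁ (u~x , ¬v~x) =
    let (y , y∈ , v~y , _) = tree-neighbour v∉ u in
    x , y , x∈ , y∈ ,
      DoublyResolves-separating u~x (≢-sym (∈-∉⇒≢ x∈ v∉)) ¬v~x v~y (≢-sym (∈-∉⇒≢ y∈ u∉))
  ... | x , x∈ , inj₂ (v~x , ¬u~x) =
    let (y , y∈ , u~y , _) = tree-neighbour u∉ v in
    ResolvedBy-sym (x , y , x∈ , y∈ ,
      DoublyResolves-separating v~x (≢-sym (∈-∉⇒≢ x∈ u∉)) ¬u~x u~y (≢-sym (∈-∉⇒≢ y∈ v∉)))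

  treeEdges-doublyResolving : IsDoublyResolving LAdj treeEdges
  treeEdges-doublyResolving = treeEdges-unique , resolved
    where
    resolved : ∀ u v → u ≢ v → ResolvedBy treeEdges u v
    resolved u v u≢v with u ∈? treeEdges | v ∈? treeEdges
    ... | yes u∈ | yes v∈ = u , v , u∈ , v∈ , DoublyResolves-self u≢v
    ... | yes u∈ | no v∉  = resolvedBy-tree-nontree u∈ v∉
    ... | no u∉  | yes v∈ = ResolvedBy-sym (resolvedBy-tree-nontree v∈ u∉)
    ... | no u∉  | no v∉  = resolvedBy-nontree u∉ v∉ u≢v

  Ψ-exists-≤ : Σ ℕ λ k → IsΨ LAdj k × k ≤ n
  Ψ-exists-≤ =
    let (k , ψ , k≤) = Ψ-exists treeEdges-doublyResolving in
    k , ψ , subst (k ≤_) length-treeEdges k≤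

theorem6 : (n : ℕ) (G : Graph n) → 3 ≤ n → Connected (Graph.Adj G) →
    Σ ℕ λ k → IsΨ (Graph.LAdj G) k ×
    ⌈log₂ (1 + Graph.Δ G) ⌉ ≤ k × k ≤ n ∸ 1
theorem6 (suc zero)       _ (s≤s ())       _
theorem6 (suc (suc zero)) _ (s≤s (s≤s ())) _
theorem6 (suc n@(suc (suc _))) G _ connected =
  let (k , ψ@((S , resolving , lenS≡k) , _) , k≤n) = Ψ-exists-≤
      -- S is nonempty as n ≥ 3 gives L(G) two distinct vertices.
      (s , _ , s∈S , _) =
        proj₂ resolving (treeEdge zero) (treeEdge (suc zero)) (Fin.0≢1+n ∘ treeEdge-injective)
  in k , ψ , subst (⌈log₂ (1 + Graph.Δ G) ⌉ ≤_) lenS≡k (⌈log₂1+Δ⌉≤ resolving s∈S) , k≤n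
  where
  open BreadthFirstTree G connected using (treeEdge; treeEdge-injective)
  open TreeEdgesResolving G connected using (Ψ-exists-≤)
  open DegreeBound G connected using (⌈log₂1+Δ⌉≤)
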